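{- Let $F$ be a discrete distribution and $d\in\mathbb{N}$, $d\ge2$. If the Markov chain induced by $F$ and $\mathrm{DNF}$ is $d$-periodic, then $\mathrm{AECR}(\mathrm{DNF},F)=1$.
   Context: Bin covering: for a list $L$ of item sizes in $[0,1]$, a bin is covered if its total size is at least $1$; $\mathrm{OPT}(L)$ is the maximum number of pairwise disjoint sets of items each of total size at least $1$. Dual Next-Fit ($\mathrm{DNF}$) puts every item (in order) into a single current bin; as soon as the current bin has total size at least $1$ it is counted as covered and a new empty current bin is started; $\mathrm{DNF}(L)$ is the number of covered bins. A discrete distribution $F$ is given by non-negative rational item sizes and positive rational probabilities summing to $1$; $I_n(F)$ is a list of $n$ i.i.d. items drawn from $F$; $\mathrm{AECR}(\mathrm{DNF},F)=\liminf_{n\to\infty}\mathbb{E}[\mathrm{DNF}(I_n(F))]/\mathbb{E}[\mathrm{OPT}(I_n(F))]$. The Markov chain induced by $\mathrm{DNF}$ and $F$: its states are the bin levels in $(0,1)$ that can arise when $\mathrm{DNF}$ packs items with sizes in the support of $F$, together with a closed state $c$ representing level $0$ and all levels $\ge1$; from a state with level $\ell$ ($\ell=0$ for $c$) one draws $X\sim F$ and moves to level $\ell+X$ if $\ell+X<1$, and to $c$ otherwise. $d$-periodic means the (common) period of the states, i.e. the gcd of return times with positive probability, equals $d$. -}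

module Defs where

open import Data.Bool using (Bool; true; false; if_then_else_)
open import Data.Nat as ℕ using (ℕ; zero; suc; _⊔_)
open import Data.Nat.Divisibility using (_∣_)
open import Data.Integer using (+_)
open import Data.Rational using (ℚ; 0ℚ; 1ℚ; _+_; _*_; _≤_; _<_; _≤ᵇ_; _/_)
open import Data.List using (List; []; _∷_; map; length; foldr; concatMap; upTo; filter; sum)
open import Data.List.Membership.Propositional using (_∈_)
open import Data.List.Relation.Unary.All using (All)
open import Data.Product using (_×_; _,_; proj₁; proj₂; ∃-syntax)
open import Relation.Binary.PropositionalEquality using (_≡_)
open import Relation.Nullary using (¬_)

ℕtoℚ : ℕ → ℚ
ℕtoℚ n = + n / 1

Σℚ : List ℚ → ℚ
Σℚ = foldr _+_ 0ℚ

Πℚ : List ℚ → ℚ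
Πℚ = foldr _*_ 1ℚ

-- Discrete distributions: a finite list of (size , probability) pairs,
-- sizes rational in [0,1], probabilities positive rationals summing to 1.

record DiscreteDist : Set where
  field
    atoms     : List (ℚ × ℚ)
    size-nonneg : All (λ a → 0ℚ ≤ proj₁ a) atoms
    size-le1    : All (λ a → proj₁ a ≤ 1ℚ) atoms
    prob-pos    : All (λ a → 0ℚ < proj₂ a) atoms
    prob-sum    : Σℚ (map proj₂ atoms) ≡ 1ℚ
open DiscreteDist public

InSupport : DiscreteDist → ℚ → Set
InSupport F x = ∃[ p ] ((x , p) ∈ atoms F)

dnfGo : ℚ → List ℚ → ℕ
dnfGo ℓ []       = 0
dnfGo ℓ (x ∷ xs) = if 1ℚ ≤ᵇ (ℓ + x) then suc (dnfGo 0ℚ xs) else dnfGo (ℓ + x) xs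

DNF : List ℚ → ℕ
DNF = dnfGo 0ℚ

-- OPT: maximum number of pairwise disjoint sets of items, each of total
-- size ≥ 1.  A choice of such sets is encoded by a labelling of the items
-- by 0 … m (m = number of items): label 0 = unused, label j ≥ 1 = j-th set.

seqs : {A : Set} → List A → ℕ → List (List A)
seqs xs zero    = [] ∷ []
seqs xs (suc n) = concatMap (λ x → map (x ∷_) (seqs xs n)) xs

labelSum : List ℚ → List ℕ → ℕ → ℚ
labelSum (x ∷ xs) (l ∷ ls) j = (if l ℕ.≡ᵇ j then x else 0ℚ) + labelSum xs ls j
labelSum _ _ j = 0ℚ

coveredSets : List ℚ → List ℕ → ℕ
coveredSets L ls = length (filter (λ j → 1ℚ Data.Rational.≤? labelSum L ls (suc j)) (upTo (length L)))

maxℕ : List ℕ → ℕ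
maxℕ = foldr _⊔_ 0

OPT : List ℚ → ℕ
OPT L = maxℕ (map (coveredSets L) (seqs (upTo (suc (length L))) (length L)))

-- Expectations over I_n(F) (n i.i.d. items drawn from F)

expect : DiscreteDist → (List ℚ → ℕ) → ℕ → ℚ
expect F f n = Σℚ (map (λ s → Πℚ (map proj₂ s) * ℕtoℚ (f (map proj₁ s)))
                       (seqs (atoms F) n))

EDNF EOPT : DiscreteDist → ℕ → ℚ
EDNF F = expect F DNF
EOPT F = expect F OPT

-- AECR(DNF,F) = liminf_n E[DNF(I_n)]/E[OPT(I_n)] equals 1, stated without
-- division: eventually E[OPT] > 0, and for every ε > 0 the ratio is
-- eventually > 1 - ε and infinitely often < 1 + ε.
AECR-DNF≡1 : DiscreteDist → Set
AECR-DNF≡1 F =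
  (∃[ N ] ∀ n → N ℕ.≤ n → 0ℚ < EOPT F n) ×
  (∀ (ε : ℚ) → 0ℚ < ε →
     (∃[ N ] ∀ n → N ℕ.≤ n → (1ℚ Data.Rational.- ε) * EOPT F n < EDNF F n) ×
     (∀ N → ∃[ n ] (N ℕ.≤ n × EDNF F n < (1ℚ + ε) * EOPT F n)))

-- The Markov chain induced by DNF and F.  A state is represented by its
-- level ℓ; the closed state c is represented by level 0 (it stands for level
-- 0 and all levels ≥ 1).

step : ℚ → ℚ → ℚ
step ℓ x = if 1ℚ ≤ᵇ (ℓ + x) then 0ℚ else ℓ + x

run : ℚ → List ℚ → ℚ
run ℓ []       = ℓ
run ℓ (x ∷ xs) = run (step ℓ x) xs

-- transitions with positive probability = items in the support of F
SupportSeq : DiscreteDist → List ℚ → Set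
SupportSeq F xs = All (InSupport F) xs

IsState : DiscreteDist → ℚ → Set
IsState F ℓ = ∃[ xs ] (SupportSeq F xs × run 0ℚ xs ≡ ℓ)

ReturnTime : DiscreteDist → ℚ → ℕ → Set
ReturnTime F ℓ k = 1 ℕ.≤ k × ∃[ xs ] (SupportSeq F xs × length xs ≡ k × run ℓ xs ≡ ℓ)

HasPeriod : DiscreteDist → ℚ → ℕ → Set
HasPeriod F ℓ d =
  (∀ k → ReturnTime F ℓ k → d ∣ k) ×
  (∀ e → (∀ k → ReturnTime F ℓ k → e ∣ k) → e ∣ d)

Periodic : DiscreteDist → ℕ → Set
Periodic F d = ∀ ℓ → IsState F ℓ → HasPeriod F ℓ d

-- Periodicity forces DNF to put the same number of items into every bin.  Let M be the
-- largest item size and T the least number of copies of M that reach 1.  If a bin holding the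
-- items p is still open but p + M would close it, then so does p + y for every item y:
-- otherwise p·M and p·y·M both lead from the closed state back to it, in lengths that differ
-- by one, which a period d ≥ 2 forbids.  Trading items for copies of M one at a time then
-- shows that any T items cover a bin while any T − 1 items do not.  So DNF covers exactly
-- ⌊n/T⌋ bins, no packing covers more, and E[DNF(I_n)] = E[OPT(I_n)] for every n.

module Submission where

open import Defs
open import Data.Nat as ℕ using (ℕ; zero; suc; _≤_; _<_; _≤′_; z≤n; s≤s; _⊔_)
import Data.Nat.Properties as ℕP
open import Data.Nat.Divisibility using (_∣_; ∣m+n∣m⇒∣n; ∣1⇒≡1; _∣0)
open import Data.Nat.Tactic.RingSolver using (solve-∀)
import Data.Integer as ℤ
import Data.Integer.Properties as ℤP
import Data.Integer.Tactic.RingSolver as ℤSolver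
open import Data.Rational as Q using (ℚ; mkℚ; 0ℚ; 1ℚ; _+_; _*_; _-_; _≤ᵇ_; toℚᵘ)
import Data.Rational.Properties as QP
import Data.Rational.Unnormalised as U
import Data.Rational.Unnormalised.Properties as UP
open import Data.List using (List; []; _∷_; _++_; length; map; replicate; filter; upTo; take; drop)
open import Data.Nat.ListAction using (sum)
import Data.List.Properties as LP
open import Data.List.Relation.Unary.All as All using (All; []; _∷_)
import Data.List.Relation.Unary.All.Properties as AllP
open import Data.List.Relation.Unary.Any using (Any; here; there)
open import Data.List.Membership.Propositional using (_∈_)
import Data.List.Membership.Propositional.Properties as MP
open import Data.List.Relation.Unary.Unique.Propositional using (Unique)
import Data.List.Relation.Unary.Unique.Propositional.Properties as UniqueP
open import Data.List.Relation.Unary.AllPairs using ([]; _∷_)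
import Data.List.Extrema
open import Data.Bool using (true; false; if_then_else_)
open import Data.Bool.Properties using (T-≡)
open import Data.Product using (_×_; _,_; proj₁; proj₂; ∃-syntax)
open import Data.Empty using (⊥-elim)
open import Function using (_∘_; Equivalence)
open import Level using (0ℓ)
open import Relation.Nullary using (¬_; yes; no)
open import Relation.Unary using (Pred; Decidable)
open import Relation.Binary.PropositionalEquality
open import Relation.Binary.Bundles using (DecTotalOrder)
open import Algebra.Properties.CommutativeSemigroup ℕP.+-commutativeSemigroup using (interchange)

open Q using () renaming (_≤_ to _≤ℚ_; _<_ to _<ℚ_; _≤?_ to _≤ℚ?_)
open Equivalence using (to; from)
module Extrema = Data.List.Extrema (DecTotalOrder.totalOrder QP.≤-decTotalOrder)

<⇒≱ : ∀ {p q} → p <ℚ q → ¬ (q ≤ℚ p)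
<⇒≱ p<q q≤p = QP.<-irrefl refl (QP.<-≤-trans p<q q≤p)

0<1 : 0ℚ <ℚ 1ℚ
0<1 = QP.positive⁻¹ 1ℚ

p≤p+q : ∀ p {q} → 0ℚ ≤ℚ q → p ≤ℚ p + q
p≤p+q p {q} 0≤q = subst (_≤ℚ p + q) (QP.+-identityʳ p) (QP.+-monoʳ-≤ p 0≤q)

p≤q+p : ∀ p {q} → 0ℚ ≤ℚ q → p ≤ℚ q + p
p≤q+p p {q} 0≤q = subst (p ≤ℚ_) (QP.+-comm p q) (p≤p+q p 0≤q)

≤ᵇ-true : ∀ {p q} → p ≤ℚ q → (p ≤ᵇ q) ≡ true
≤ᵇ-true = to T-≡ ∘ QP.≤⇒≤ᵇ

≤ᵇ-false : ∀ {p q} → q <ℚ p → (p ≤ᵇ q) ≡ false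
≤ᵇ-false {p} {q} q<p with p ≤ᵇ q in eq
... | true  = ⊥-elim (<⇒≱ q<p (QP.≤ᵇ⇒≤ (from T-≡ eq)))
... | false = refl

Σℚ-++ : ∀ u v → Σℚ (u ++ v) ≡ Σℚ u + Σℚ v
Σℚ-++ []      v = sym (QP.+-identityˡ (Σℚ v))
Σℚ-++ (x ∷ u) v = trans (cong (x +_) (Σℚ-++ u v)) (sym (QP.+-assoc x (Σℚ u) (Σℚ v)))

Σℚ-insert : ∀ u y v → Σℚ (u ++ y ∷ v) ≡ Σℚ (u ++ v) + y
Σℚ-insert []      y v = QP.+-comm y (Σℚ v)
Σℚ-insert (x ∷ u) y v = trans (cong (x +_) (Σℚ-insert u y v)) (sym (QP.+-assoc x (Σℚ (u ++ v)) y))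

Σℚ-nonneg : ∀ {u} → All (0ℚ ≤ℚ_) u → 0ℚ ≤ℚ Σℚ u
Σℚ-nonneg []         = QP.≤-refl
Σℚ-nonneg (0≤x ∷ 0≤u) = QP.≤-trans 0≤x (p≤p+q _ (Σℚ-nonneg 0≤u))

Σℚ-pos : ∀ {y u} → All (0ℚ ≤ℚ_) u → y ∈ u → 0ℚ <ℚ y → 0ℚ <ℚ Σℚ u
Σℚ-pos (_ ∷ 0≤u) (here refl) 0<y = QP.<-≤-trans 0<y (p≤p+q _ (Σℚ-nonneg 0≤u))
Σℚ-pos (0≤x ∷ 0≤u) (there y∈u) 0<y = QP.<-≤-trans (Σℚ-pos 0≤u y∈u 0<y) (p≤q+p _ 0≤x)

Σℚ-replicate-mono : ∀ {x} → 0ℚ ≤ℚ x → ∀ {j k} → j ≤ k → Σℚ (replicate j x) ≤ℚ Σℚ (replicate k x)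
Σℚ-replicate-mono 0≤x {k = k} z≤n   = Σℚ-nonneg (AllP.replicate⁺ k 0≤x)
Σℚ-replicate-mono {x} 0≤x (s≤s j≤k) = QP.+-monoʳ-≤ x (Σℚ-replicate-mono 0≤x j≤k)

Σℚ≤Σℚ-replicate : ∀ {x u} → All (_≤ℚ x) u → Σℚ u ≤ℚ Σℚ (replicate (length u) x)
Σℚ≤Σℚ-replicate []          = QP.≤-refl
Σℚ≤Σℚ-replicate (y≤x ∷ u≤x) = QP.+-mono-≤ y≤x (Σℚ≤Σℚ-replicate u≤x)

Σℚ-replicate-≃ : ∀ x k → toℚᵘ (Σℚ (replicate k x)) U.≃ U.mkℚᵘ (ℤ.+ k ℤ.* Q.↥ x) (ℕ.pred (Q.↧ₙ x))
Σℚ-replicate-≃ (mkℚ n d-1 _) zero = U.*≡* (cong (ℤ._* ℤ.+ 1) (sym (ℤP.*-zeroˡ n)))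
Σℚ-replicate-≃ x@(mkℚ n d-1 _) (suc k) = UP.≃-trans (QP.toℚᵘ-homo-+ x (Σℚ (replicate k x)))
  (UP.≃-trans (UP.+-congʳ (toℚᵘ x) (Σℚ-replicate-≃ x k)) (U.*≡* (cross-multiplied n (ℤ.+ k) (ℤ.+ suc d-1))))
  where
  cross-multiplied : ∀ n k d → (n ℤ.* d ℤ.+ (k ℤ.* n) ℤ.* d) ℤ.* d ≡ ((ℤ.1ℤ ℤ.+ k) ℤ.* n) ℤ.* (d ℤ.* d)
  cross-multiplied = ℤSolver.solve-∀

archimedean : ∀ {x} → 0ℚ <ℚ x → ∃[ k ] (1ℚ ≤ℚ Σℚ (replicate k x))
archimedean {x@(mkℚ (ℤ.+ suc n) d-1 _)} _ =
  suc d-1 , QP.toℚᵘ-cancel-≤ (UP.≤-respʳ-≃ (UP.≃-sym (Σℚ-replicate-≃ x (suc d-1))) (U.*≤* d≤d*n))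
  where
  d≤d*n : ℤ.+ 1 ℤ.* ℤ.+ suc d-1 ℤ.≤ (ℤ.+ suc d-1 ℤ.* ℤ.+ suc n) ℤ.* ℤ.+ 1
  d≤d*n rewrite ℤP.*-identityˡ (ℤ.+ suc d-1) | ℤP.*-identityʳ (ℤ.+ suc d-1 ℤ.* ℤ.+ suc n)
              | sym (ℤP.pos-* (suc d-1) (suc n)) = ℤ.+≤+ (ℕP.m≤m*n (suc d-1) (suc n))
archimedean {mkℚ (ℤ.+ zero) _ _} (Q.*<* (ℤ.+<+ ()))
archimedean {mkℚ ℤ.-[1+ _ ] _ _} (Q.*<* ())

first-crossing : ∀ x k → 1ℚ ≤ℚ Σℚ (replicate k x) →
                ∃[ t ] (Σℚ (replicate t x) <ℚ 1ℚ × 1ℚ ≤ℚ Σℚ (replicate (suc t) x))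
first-crossing x zero    1≤0 = ⊥-elim (<⇒≱ 0<1 1≤0)
first-crossing x (suc k) 1≤Σ with 1ℚ ≤ℚ? Σℚ (replicate k x)
... | yes 1≤Σ′ = first-crossing x k 1≤Σ′
... | no  1≰Σ′ = k , QP.≰⇒> 1≰Σ′ , 1≤Σ

step-< : ∀ {ℓ x} → ℓ + x <ℚ 1ℚ → step ℓ x ≡ ℓ + x
step-< ℓ+x<1 rewrite ≤ᵇ-false ℓ+x<1 = refl

step-≥ : ∀ {ℓ x} → 1ℚ ≤ℚ ℓ + x → step ℓ x ≡ 0ℚ
step-≥ 1≤ℓ+x rewrite ≤ᵇ-true 1≤ℓ+x = refl

dnfGo-< : ∀ {ℓ x} w → ℓ + x <ℚ 1ℚ → dnfGo ℓ (x ∷ w) ≡ dnfGo (ℓ + x) w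
dnfGo-< w ℓ+x<1 rewrite ≤ᵇ-false ℓ+x<1 = refl

dnfGo-≥ : ∀ {ℓ x} w → 1ℚ ≤ℚ ℓ + x → dnfGo ℓ (x ∷ w) ≡ suc (dnfGo 0ℚ w)
dnfGo-≥ w 1≤ℓ+x rewrite ≤ᵇ-true 1≤ℓ+x = refl

run-++ : ∀ ℓ u v → run ℓ (u ++ v) ≡ run (run ℓ u) v
run-++ ℓ []      v = refl
run-++ ℓ (x ∷ u) v = run-++ (step ℓ x) u v

run-< : ∀ ℓ {u} → All (0ℚ ≤ℚ_) u → ℓ + Σℚ u <ℚ 1ℚ → run ℓ u ≡ ℓ + Σℚ u
run-< ℓ []          _       = sym (QP.+-identityʳ ℓ)
run-< ℓ {x ∷ u} (0≤x ∷ 0≤u) ℓ+Σ<1 = begin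
  run (step ℓ x) u ≡⟨ cong (λ ℓ′ → run ℓ′ u) (step-< {ℓ} {x} ℓ+x<1) ⟩
  run (ℓ + x) u    ≡⟨ run-< (ℓ + x) 0≤u ℓ+x+Σ<1 ⟩
  ℓ + x + Σℚ u     ≡⟨ QP.+-assoc ℓ x (Σℚ u) ⟩
  ℓ + (x + Σℚ u)   ∎
  where
  open ≡-Reasoning
  ℓ+x+Σ<1 : ℓ + x + Σℚ u <ℚ 1ℚ
  ℓ+x+Σ<1 = subst (_<ℚ 1ℚ) (sym (QP.+-assoc ℓ x (Σℚ u))) ℓ+Σ<1
  ℓ+x<1 : ℓ + x <ℚ 1ℚ
  ℓ+x<1 = QP.≤-<-trans (p≤p+q (ℓ + x) (Σℚ-nonneg 0≤u)) ℓ+x+Σ<1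

sum-map-zero : ∀ {A : Set} (xs : List A) → sum (map (λ _ → 0) xs) ≡ 0
sum-map-zero []       = refl
sum-map-zero (_ ∷ xs) = sum-map-zero xs

sum-map-+ : ∀ {A : Set} (f g : A → ℕ) xs → sum (map (λ x → f x ℕ.+ g x) xs) ≡ sum (map f xs) ℕ.+ sum (map g xs)
sum-map-+ f g []       = refl
sum-map-+ f g (x ∷ xs) = trans (cong (f x ℕ.+ g x ℕ.+_) (sum-map-+ f g xs))
                               (interchange (f x) (g x) (sum (map f xs)) (sum (map g xs)))

length-filter*≤sum : ∀ {A : Set} {P : Pred A 0ℓ} (P? : Decidable P) (c : A → ℕ) {K} →
                     (∀ {x} → P x → K ≤ c x) → ∀ xs → length (filter P? xs) ℕ.* K ≤ sum (map c xs)
length-filter*≤sum P? c K≤c [] = z≤n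
length-filter*≤sum P? c K≤c (x ∷ xs) with P? x
... | yes px = ℕP.+-mono-≤ (K≤c px) (length-filter*≤sum P? c K≤c xs)
... | no  _  = ℕP.≤-trans (length-filter*≤sum P? c K≤c xs) (ℕP.m≤n+m _ (c x))

length-filter-upTo-mono : ∀ {P : Pred ℕ 0ℓ} (P? : Decidable P) {m n} → m ≤′ n →
                          length (filter P? (upTo m)) ≤ length (filter P? (upTo n))
length-filter-upTo-mono P? ℕ.≤′-refl = ℕP.≤-refl
length-filter-upTo-mono P? {n = suc n} (ℕ.≤′-step m≤′n) =
  ℕP.≤-trans (length-filter-upTo-mono P? m≤′n)
    (subst (λ js → length (filter P? (upTo n)) ≤ length (filter P? js)) (LP.upTo-∷ʳ n)
      (subst (length (filter P? (upTo n)) ≤_) (sym (cong length (LP.filter-++ P? (upTo n) (n ∷ []))))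
        (subst (length (filter P? (upTo n)) ≤_) (sym (LP.length-++ (filter P? (upTo n))))
          (ℕP.m≤m+n _ _))))

≤-length-filter-upTo : ∀ {P : Pred ℕ 0ℓ} (P? : Decidable P) {q n} →
                       (∀ {j} → j < q → P j) → q ≤ n → q ≤ length (filter P? (upTo n))
≤-length-filter-upTo P? {q} P<q q≤n = ℕP.≤-trans
  (ℕP.≤-reflexive (sym (trans (cong length (LP.filter-all P? (All.tabulate (P<q ∘ MP.∈-upTo⁻)))) (LP.length-upTo q))))
  (length-filter-upTo-mono P? (ℕP.≤⇒≤′ q≤n))

≤-maxℕ : ∀ {x xs} → x ∈ xs → x ≤ maxℕ xs
≤-maxℕ {xs = y ∷ xs} (here refl) = ℕP.m≤m⊔n y (maxℕ xs)
≤-maxℕ {xs = y ∷ xs} (there x∈xs) = ℕP.≤-trans (≤-maxℕ x∈xs) (ℕP.m≤n⊔m y (maxℕ xs))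

maxℕ-≤ : ∀ {k xs} → All (_≤ k) xs → maxℕ xs ≤ k
maxℕ-≤ []             = z≤n
maxℕ-≤ (x≤k ∷ xs≤k) = ℕP.⊔-lub x≤k (maxℕ-≤ xs≤k)

∈-seqs⁺ : ∀ {A : Set} (xs : List A) {s} → All (_∈ xs) s → s ∈ seqs xs (length s)
∈-seqs⁺ xs []                       = here refl
∈-seqs⁺ xs {x ∷ s} (x∈xs ∷ s⊆xs) =
  MP.∈-concatMap⁺ (λ y → map (y ∷_) (seqs xs (length s))) (extend x∈xs)
  where
  extend : ∀ {ys} → x ∈ ys → Any (λ y → x ∷ s ∈ map (y ∷_) (seqs xs (length s))) ys
  extend (here refl)  = here (MP.∈-map⁺ (x ∷_) (∈-seqs⁺ xs s⊆xs))
  extend (there x∈ys) = there (extend x∈ys)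

∈-seqs⁻ : ∀ {A : Set} (xs : List A) n {s} → s ∈ seqs xs n → All (_∈ xs) s
∈-seqs⁻ xs zero    (here refl) = []
∈-seqs⁻ xs (suc n) {s} s∈ = pick xs (λ y∈xs → y∈xs) (MP.∈-concatMap⁻ (λ y → map (y ∷_) (seqs xs n)) {xs = xs} s∈)
  where
  pick : ∀ ys → (∀ {y} → y ∈ ys → y ∈ xs) → Any (λ y → s ∈ map (y ∷_) (seqs xs n)) ys → All (_∈ xs) s
  pick (y ∷ ys) ys⊆xs (here s∈) with MP.∈-map⁻ (y ∷_) s∈
  ... | s′ , s′∈ , refl = ys⊆xs (here refl) ∷ ∈-seqs⁻ xs n s′∈
  pick (y ∷ ys) ys⊆xs (there s∈) = pick ys (ys⊆xs ∘ there) s∈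

classOf : List ℚ → List ℕ → ℕ → List ℚ
classOf (x ∷ L) (l ∷ ls) j = if l ℕ.≡ᵇ j then x ∷ classOf L ls j else classOf L ls j
classOf _       _        _ = []

labelSum≡Σℚ-classOf : ∀ L ls j → labelSum L ls j ≡ Σℚ (classOf L ls j)
labelSum≡Σℚ-classOf []      ls       j = refl
labelSum≡Σℚ-classOf (x ∷ L) []       j = refl
labelSum≡Σℚ-classOf (x ∷ L) (l ∷ ls) j with l ℕ.≡ᵇ j
... | true  = cong (x +_) (labelSum≡Σℚ-classOf L ls j)
... | false = trans (QP.+-identityˡ _) (labelSum≡Σℚ-classOf L ls j)

classOf-All : ∀ {P : Pred ℚ 0ℓ} {L} → All P L → ∀ ls j → All P (classOf L ls j)
classOf-All []         ls       j = []
classOf-All (_ ∷ _)    []       j = []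
classOf-All {L = x ∷ L} (px ∷ pL) (l ∷ ls) j with l ℕ.≡ᵇ j
... | true  = px ∷ classOf-All pL ls j
... | false = classOf-All pL ls j

classOf-++ : ∀ u v ls ms j → length u ≡ length ls →
             classOf (u ++ v) (ls ++ ms) j ≡ classOf u ls j ++ classOf v ms j
classOf-++ []      v []       ms j _ = refl
classOf-++ (x ∷ u) v (l ∷ ls) ms j |u|≡|ls| with l ℕ.≡ᵇ j
... | true  = cong (x ∷_) (classOf-++ u v ls ms j (ℕP.suc-injective |u|≡|ls|))
... | false = classOf-++ u v ls ms j (ℕP.suc-injective |u|≡|ls|)

classOf-replicate : ∀ u j → classOf u (replicate (length u) j) j ≡ u
classOf-replicate []      j = refl
classOf-replicate (x ∷ u) j rewrite to T-≡ (ℕP.≡⇒≡ᵇ j j refl) = cong (x ∷_) (classOf-replicate u j)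

length-classOf-∷ : ∀ x L l ls j →
                   length (classOf (x ∷ L) (l ∷ ls) j) ≡ (if l ℕ.≡ᵇ j then 1 else 0) ℕ.+ length (classOf L ls j)
length-classOf-∷ x L l ls j with l ℕ.≡ᵇ j
... | true  = refl
... | false = refl

indicator-sum≡0 : ∀ l {js} → All (l ≢_) js → sum (map (λ j → if l ℕ.≡ᵇ j then 1 else 0) js) ≡ 0
indicator-sum≡0 l []                       = refl
indicator-sum≡0 l {j ∷ js} (l≢j ∷ l∉js) with l ℕ.≡ᵇ j in eq
... | true  = ⊥-elim (l≢j (ℕP.≡ᵇ⇒≡ l j (from T-≡ eq)))
... | false = indicator-sum≡0 l l∉js

indicator-sum≤1 : ∀ l {js} → Unique js → sum (map (λ j → if l ℕ.≡ᵇ j then 1 else 0) js) ≤ 1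
indicator-sum≤1 l []                      = z≤n
indicator-sum≤1 l {j ∷ js} (j∉js ∷ js!) with l ℕ.≡ᵇ j in eq
... | true  rewrite ℕP.≡ᵇ⇒≡ l j (from T-≡ eq) | indicator-sum≡0 j j∉js = ℕP.≤-refl
... | false = indicator-sum≤1 l js!

sum-length-classOf : ∀ L ls {js} → Unique js → sum (map (λ j → length (classOf L ls j)) js) ≤ length L
sum-length-classOf []      ls       {js} _   = subst (_≤ _) (sym (sum-map-zero js)) z≤n
sum-length-classOf (x ∷ L) []       {js} _   = subst (_≤ _) (sym (sum-map-zero js)) z≤n
sum-length-classOf (x ∷ L) (l ∷ ls) {js} js! = begin
  sum (map (λ j → length (classOf (x ∷ L) (l ∷ ls) j)) js)
    ≡⟨ cong sum (LP.map-cong (length-classOf-∷ x L l ls) js) ⟩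
  sum (map (λ j → (if l ℕ.≡ᵇ j then 1 else 0) ℕ.+ length (classOf L ls j)) js)
    ≡⟨ sum-map-+ _ _ js ⟩
  sum (map (λ j → if l ℕ.≡ᵇ j then 1 else 0) js) ℕ.+ sum (map (λ j → length (classOf L ls j)) js)
    ≤⟨ ℕP.+-mono-≤ (indicator-sum≤1 l js!) (sum-length-classOf L ls js!) ⟩
  suc (length L) ∎
  where open ℕP.≤-Reasoning

module UniformBins (S : Pred ℚ 0ℓ) (t : ℕ)
  (S-nonneg   : ∀ {x} → S x → 0ℚ ≤ℚ x)
  (short-Σ<1  : ∀ {u} → All S u → length u ≤ t → Σℚ u <ℚ 1ℚ)
  (full-1≤Σ   : ∀ {u} → All S u → length u ≡ suc t → 1ℚ ≤ℚ Σℚ u) where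

  T : ℕ
  T = suc t

  -- u is the content of the current bin, ℓ its level.
  dnfGo-shape : ∀ w {u ℓ} → All S w → All S u → length u ≤ t → ℓ ≡ Σℚ u →
                ∃[ r ] (r < T × length w ℕ.+ length u ≡ dnfGo ℓ w ℕ.* T ℕ.+ r)
  dnfGo-shape []      {u} _         _  |u|≤t _ = length u , s≤s |u|≤t , refl
  dnfGo-shape (x ∷ w) {u} {ℓ} (Sx ∷ Sw) Su |u|≤t ℓ≡Σu with length u ℕP.≟ t
  ... | yes |u|≡t with dnfGo-shape w Sw [] z≤n refl
  ...   | r , r<T , |w|≡ = r , r<T , (begin
    suc (length w ℕ.+ length u)           ≡⟨ cong₂ (λ a b → suc (a ℕ.+ b)) (trans (sym (ℕP.+-identityʳ _)) |w|≡) |u|≡t ⟩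
    suc (dnfGo 0ℚ w ℕ.* T ℕ.+ r ℕ.+ t)    ≡⟨ close (dnfGo 0ℚ w) r t ⟩
    suc (dnfGo 0ℚ w) ℕ.* T ℕ.+ r          ≡⟨ cong (λ D → D ℕ.* T ℕ.+ r) (sym (dnfGo-≥ {ℓ} w 1≤ℓ+x)) ⟩
    dnfGo ℓ (x ∷ w) ℕ.* T ℕ.+ r           ∎)
    where
    open ≡-Reasoning
    close : ∀ D r t → suc (D ℕ.* suc t ℕ.+ r ℕ.+ t) ≡ suc D ℕ.* suc t ℕ.+ r
    close = solve-∀
    1≤ℓ+x : 1ℚ ≤ℚ ℓ + x
    1≤ℓ+x = subst (1ℚ ≤ℚ_) (trans (QP.+-comm x (Σℚ u)) (cong (_+ x) (sym ℓ≡Σu))) (full-1≤Σ (Sx ∷ Su) (cong suc |u|≡t))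
  dnfGo-shape (x ∷ w) {u} {ℓ} (Sx ∷ Sw) Su |u|≤t ℓ≡Σu | no |u|≢t
    with dnfGo-shape w Sw (Sx ∷ Su) (ℕP.≤∧≢⇒< |u|≤t |u|≢t) ℓ+x≡Σ
    where
    ℓ+x≡Σ : ℓ + x ≡ x + Σℚ u
    ℓ+x≡Σ = trans (cong (_+ x) ℓ≡Σu) (QP.+-comm (Σℚ u) x)
  ... | r , r<T , |w|≡ = r , r<T , (begin
    suc (length w ℕ.+ length u)   ≡⟨ sym (ℕP.+-suc (length w) (length u)) ⟩
    length w ℕ.+ suc (length u)   ≡⟨ |w|≡ ⟩
    dnfGo (ℓ + x) w ℕ.* T ℕ.+ r   ≡⟨ cong (λ D → D ℕ.* T ℕ.+ r) (sym (dnfGo-< {ℓ} w ℓ+x<1)) ⟩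
    dnfGo ℓ (x ∷ w) ℕ.* T ℕ.+ r   ∎)
    where
    open ≡-Reasoning
    ℓ+x<1 : ℓ + x <ℚ 1ℚ
    ℓ+x<1 = subst (_<ℚ 1ℚ) (trans (QP.+-comm x (Σℚ u)) (cong (_+ x) (sym ℓ≡Σu)))
                  (short-Σ<1 (Sx ∷ Su) (ℕP.≤∧≢⇒< |u|≤t |u|≢t))

  DNF-shape : ∀ {L} → All S L → ∃[ r ] (r < T × length L ≡ DNF L ℕ.* T ℕ.+ r)
  DNF-shape {L} SL with dnfGo-shape L SL [] z≤n refl
  ... | r , r<T , |L|≡ = r , r<T , trans (sym (ℕP.+-identityʳ (length L))) |L|≡

  Σℚ-classOf-nonneg : ∀ {L} → All S L → ∀ ls j → 0ℚ ≤ℚ Σℚ (classOf L ls j)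
  Σℚ-classOf-nonneg SL ls j = Σℚ-nonneg (All.map S-nonneg (classOf-All SL ls j))

  covering-length : ∀ {C} → All S C → 1ℚ ≤ℚ Σℚ C → T ≤ length C
  covering-length {C} SC 1≤ΣC with length C ℕP.≤? t
  ... | yes |C|≤t = ⊥-elim (<⇒≱ (short-Σ<1 SC |C|≤t) 1≤ΣC)
  ... | no  |C|≰t = ℕP.≰⇒> |C|≰t

  coveredSets*T≤length : ∀ {L} → All S L → ∀ ls → coveredSets L ls ℕ.* T ≤ length L
  coveredSets*T≤length {L} SL ls = begin
    coveredSets L ls ℕ.* T
      ≤⟨ length-filter*≤sum (λ j → 1ℚ Q.≤? labelSum L ls (suc j)) (λ j → length (classOf L ls (suc j)))
           (λ {j} covered → covering-length (classOf-All SL ls (suc j)) (subst (1ℚ ≤ℚ_) (labelSum≡Σℚ-classOf L ls (suc j)) covered))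
           (upTo (length L)) ⟩
    sum (map (λ j → length (classOf L ls (suc j))) (upTo (length L)))
      ≡⟨ cong sum (LP.map-∘ (upTo (length L))) ⟩
    sum (map (λ j → length (classOf L ls j)) (map suc (upTo (length L))))
      ≤⟨ sum-length-classOf L ls (UniqueP.map⁺ ℕP.suc-injective (UniqueP.upTo⁺ (length L))) ⟩
    length L ∎
    where open ℕP.≤-Reasoning

  OPT≤DNF : ∀ {L} → All S L → OPT L ≤ DNF L
  OPT≤DNF {L} SL with DNF-shape SL
  ... | r , r<T , |L|≡ = maxℕ-≤ (AllP.map⁺ (All.universal covered≤DNF (seqs (upTo (suc (length L))) (length L))))
    where
    covered≤DNF : ∀ ls → coveredSets L ls ≤ DNF L
    covered≤DNF ls = ℕP.≤-pred (ℕP.*-cancelʳ-< T (coveredSets L ls) (suc (DNF L)) (begin-strict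
      coveredSets L ls ℕ.* T    ≤⟨ coveredSets*T≤length SL ls ⟩
      length L                  ≡⟨ |L|≡ ⟩
      DNF L ℕ.* T ℕ.+ r         <⟨ ℕP.+-monoʳ-< (DNF L ℕ.* T) r<T ⟩
      DNF L ℕ.* T ℕ.+ T         ≡⟨ ℕP.+-comm (DNF L ℕ.* T) T ⟩
      suc (DNF L) ℕ.* T         ∎))
      where open ℕP.≤-Reasoning

  blockLabels : ℕ → ℕ → ℕ → List ℕ
  blockLabels k zero    r = replicate r 0
  blockLabels k (suc q) r = replicate T k ++ blockLabels (suc k) q r

  length-blockLabels : ∀ k q r → length (blockLabels k q r) ≡ q ℕ.* T ℕ.+ r
  length-blockLabels k zero    r = LP.length-replicate r
  length-blockLabels k (suc q) r = begin
    length (replicate T k ++ blockLabels (suc k) q r)        ≡⟨ LP.length-++ (replicate T k) ⟩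
    length (replicate T k) ℕ.+ length (blockLabels (suc k) q r) ≡⟨ cong₂ ℕ._+_ (LP.length-replicate T) (length-blockLabels (suc k) q r) ⟩
    T ℕ.+ (q ℕ.* T ℕ.+ r)                                    ≡⟨ sym (ℕP.+-assoc T (q ℕ.* T) r) ⟩
    suc q ℕ.* T ℕ.+ r                                        ∎
    where open ≡-Reasoning

  blockLabels-≤ : ∀ k q r → All (_≤ k ℕ.+ q) (blockLabels (suc k) q r)
  blockLabels-≤ k zero    r = AllP.replicate⁺ r z≤n
  blockLabels-≤ k (suc q) r rewrite ℕP.+-suc k q =
    AllP.++⁺ (AllP.replicate⁺ T (s≤s (ℕP.m≤m+n k q))) (blockLabels-≤ (suc k) q r)

  blockLabels-cover : ∀ q {r k L} → All S L → length L ≡ q ℕ.* T ℕ.+ r →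
                      ∀ {j} → k ≤ j → j < k ℕ.+ q → 1ℚ ≤ℚ Σℚ (classOf L (blockLabels k q r) j)
  blockLabels-cover zero {k = k} _ _ {j} k≤j j<k+0 = ⊥-elim (ℕP.<⇒≱ (subst (j <_) (ℕP.+-identityʳ k) j<k+0) k≤j)
  blockLabels-cover (suc q) {r} {k} {L} SL |L|≡ {j} k≤j j<k+q+1 =
    subst (λ L′ → 1ℚ ≤ℚ Σℚ (classOf L′ (blockLabels k (suc q) r) j)) (LP.take++drop≡id T L)
      (subst (1ℚ ≤ℚ_) (sym Σ-split) covers)
    where
    u v : List ℚ
    u = take T L
    v = drop T L
    Su : All S u
    Su = AllP.take⁺ T SL
    Sv : All S v
    Sv = AllP.drop⁺ T SL
    |u|≡T : length u ≡ T
    |u|≡T = trans (LP.length-take T L) (ℕP.m≤n⇒m⊓n≡m (subst (T ≤_) (sym (trans |L|≡ (ℕP.+-assoc T _ r))) (ℕP.m≤m+n T _)))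
    |v|≡ : length v ≡ q ℕ.* T ℕ.+ r
    |v|≡ = trans (LP.length-drop T L) (trans (cong (ℕ._∸ T) (trans |L|≡ (ℕP.+-assoc T _ r))) (ℕP.m+n∸m≡n T _))
    Σ-split : Σℚ (classOf (u ++ v) (replicate T k ++ blockLabels (suc k) q r) j)
            ≡ Σℚ (classOf u (replicate T k) j) + Σℚ (classOf v (blockLabels (suc k) q r) j)
    Σ-split = trans (cong Σℚ (classOf-++ u v (replicate T k) (blockLabels (suc k) q r) j (trans |u|≡T (sym (LP.length-replicate T)))))
                    (Σℚ-++ (classOf u (replicate T k) j) (classOf v (blockLabels (suc k) q r) j))
    covers : 1ℚ ≤ℚ Σℚ (classOf u (replicate T k) j) + Σℚ (classOf v (blockLabels (suc k) q r) j)
    covers with k ℕP.≟ j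
    ... | yes refl = QP.≤-trans
            (subst (λ n → 1ℚ ≤ℚ Σℚ (classOf u (replicate n k) k)) |u|≡T
              (subst (λ C → 1ℚ ≤ℚ Σℚ C) (sym (classOf-replicate u k)) (full-1≤Σ Su |u|≡T)))
            (p≤p+q _ (Σℚ-classOf-nonneg Sv _ k))
    ... | no  k≢j  = QP.≤-trans
            (blockLabels-cover q Sv |v|≡ (ℕP.≤∧≢⇒< k≤j k≢j) (subst (j <_) (ℕP.+-suc k q) j<k+q+1))
            (p≤q+p _ (Σℚ-classOf-nonneg Su _ j))

  DNF≤OPT : ∀ {L} → All S L → DNF L ≤ OPT L
  DNF≤OPT {L} SL with DNF-shape SL
  ... | r , _ , |L|≡ = ℕP.≤-trans D≤covered (≤-maxℕ (MP.∈-map⁺ (coveredSets L) ls∈))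
    where
    D n : ℕ
    D = DNF L
    n = length L
    ls : List ℕ
    ls = blockLabels 1 D r
    D≤n : D ≤ n
    D≤n = subst (D ≤_) (sym |L|≡) (ℕP.≤-trans (ℕP.m≤m*n D T) (ℕP.m≤m+n _ r))
    D≤covered : D ≤ coveredSets L ls
    D≤covered = ≤-length-filter-upTo (λ j → 1ℚ Q.≤? labelSum L ls (suc j))
      (λ {j} j<D → subst (1ℚ ≤ℚ_) (sym (labelSum≡Σℚ-classOf L ls (suc j))) (blockLabels-cover D SL |L|≡ (s≤s z≤n) (s≤s j<D)))
      D≤n
    ls∈ : ls ∈ seqs (upTo (suc n)) n
    ls∈ = subst (λ m → ls ∈ seqs (upTo (suc n)) m) (trans (length-blockLabels 1 D r) (sym |L|≡))
            (∈-seqs⁺ (upTo (suc n)) (All.map (λ l≤D → MP.∈-upTo⁺ (s≤s (ℕP.≤-trans l≤D D≤n))) (blockLabels-≤ 0 D r)))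

  OPT≡DNF : ∀ {L} → All S L → OPT L ≡ DNF L
  OPT≡DNF SL = ℕP.≤-antisym (OPT≤DNF SL) (DNF≤OPT SL)

  OPT-pos : ∀ {L} → All S L → T ≤ length L → 0 < OPT L
  OPT-pos {L} SL T≤|L| with DNF-shape SL | OPT≡DNF SL
  ... | r , r<T , |L|≡ | OPT≡D with DNF L
  ...   | zero  = ⊥-elim (ℕP.<⇒≱ r<T (subst (T ≤_) |L|≡ T≤|L|))
  ...   | suc _ = subst (0 <_) (sym OPT≡D) (s≤s z≤n)

*-nonneg : ∀ {p q} → 0ℚ ≤ℚ p → 0ℚ ≤ℚ q → 0ℚ ≤ℚ p * q
*-nonneg {p} {q} 0≤p 0≤q = QP.nonNegative⁻¹ (p * q) {{QP.nonNeg*nonNeg⇒nonNeg p {{Q.nonNegative 0≤p}} q {{Q.nonNegative 0≤q}}}}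

*-pos : ∀ {p q} → 0ℚ <ℚ p → 0ℚ <ℚ q → 0ℚ <ℚ p * q
*-pos {p} {q} 0<p 0<q = QP.positive⁻¹ (p * q) {{QP.pos*pos⇒pos p {{Q.positive 0<p}} q {{Q.positive 0<q}}}}

Πℚ-pos : ∀ {ps} → All (0ℚ <ℚ_) ps → 0ℚ <ℚ Πℚ ps
Πℚ-pos []           = 0<1
Πℚ-pos (0<p ∷ 0<ps) = *-pos 0<p (Πℚ-pos 0<ps)

ℕtoℚ-nonneg : ∀ k → 0ℚ ≤ℚ ℕtoℚ k
ℕtoℚ-nonneg k = QP.nonNegative⁻¹ (ℕtoℚ k) {{QP.normalize-nonNeg k 1}}

ℕtoℚ-pos : ∀ {k} → 0 < k → 0ℚ <ℚ ℕtoℚ k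
ℕtoℚ-pos {suc k} _ = QP.positive⁻¹ (ℕtoℚ (suc k)) {{QP.normalize-pos (suc k) 1}}

module _ (F : DiscreteDist) where

  drawn-support : ∀ n {s} → s ∈ seqs (atoms F) n → SupportSeq F (map proj₁ s)
  drawn-support n s∈ = AllP.map⁺ (All.map (λ {a} a∈ → proj₂ a , a∈) (∈-seqs⁻ (atoms F) n s∈))

  drawn-prob-pos : ∀ n {s} → s ∈ seqs (atoms F) n → 0ℚ <ℚ Πℚ (map proj₂ s)
  drawn-prob-pos n s∈ = Πℚ-pos (AllP.map⁺ (All.map (All.lookup (prob-pos F)) (∈-seqs⁻ (atoms F) n s∈)))

  EDNF≡EOPT : (∀ {L} → SupportSeq F L → OPT L ≡ DNF L) → ∀ n → EDNF F n ≡ EOPT F n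
  EDNF≡EOPT OPT≡DNF n = cong Σℚ (LP.map-cong-local {xs = seqs (atoms F) n} (All.tabulate λ {s} s∈ →
    cong (λ k → Πℚ (map proj₂ s) * ℕtoℚ k) (sym (OPT≡DNF (drawn-support n s∈)))))

  some-atom : ∃[ a ] (a ∈ atoms F)
  some-atom with atoms F | prob-sum F
  ... | []    | Σ≡1 = ⊥-elim (QP.1≢0 (sym Σ≡1))
  ... | a ∷ _ | _   = a , here refl

  EOPT-pos : ∀ {T} → (∀ {L} → SupportSeq F L → T ≤ length L → 0 < OPT L) → ∀ n → T ≤ n → 0ℚ <ℚ EOPT F n
  EOPT-pos {T} OPT-pos n T≤n = Σℚ-pos (AllP.map⁺ (All.tabulate term-nonneg)) (MP.∈-map⁺ term s₀∈) term-pos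
    where
    term : List (ℚ × ℚ) → ℚ
    term s = Πℚ (map proj₂ s) * ℕtoℚ (OPT (map proj₁ s))
    term-nonneg : ∀ {s} → s ∈ seqs (atoms F) n → 0ℚ ≤ℚ term s
    term-nonneg {s} s∈ = *-nonneg (QP.<⇒≤ (drawn-prob-pos n s∈)) (ℕtoℚ-nonneg (OPT (map proj₁ s)))
    s₀ : List (ℚ × ℚ)
    s₀ = replicate n (proj₁ some-atom)
    s₀∈ : s₀ ∈ seqs (atoms F) n
    s₀∈ = subst (λ m → s₀ ∈ seqs (atoms F) m) (LP.length-replicate n)
            (∈-seqs⁺ (atoms F) (AllP.replicate⁺ n (proj₂ some-atom)))
    T≤|L₀| : T ≤ length (map proj₁ s₀)
    T≤|L₀| = subst (T ≤_) (sym (trans (LP.length-map proj₁ s₀) (LP.length-replicate n))) T≤n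
    term-pos : 0ℚ <ℚ term s₀
    term-pos = *-pos (drawn-prob-pos n s₀∈) (ℕtoℚ-pos (OPT-pos (drawn-support n s₀∈) T≤|L₀|))

  AECR-DNF≡1-if-optimal : ∀ T → (∀ {L} → SupportSeq F L → OPT L ≡ DNF L) →
                          (∀ {L} → SupportSeq F L → T ≤ length L → 0 < OPT L) → AECR-DNF≡1 F
  AECR-DNF≡1-if-optimal T OPT≡DNF OPT-pos = (T , EOPT-pos′) , λ ε 0<ε →
    (T , λ n T≤n → below n T≤n 0<ε) ,
    (λ N → N ⊔ T , ℕP.m≤m⊔n N T , above (N ⊔ T) (ℕP.m≤n⊔m N T) 0<ε)
    where
    EOPT-pos′ : ∀ n → T ≤ n → 0ℚ <ℚ EOPT F n
    EOPT-pos′ = EOPT-pos OPT-pos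
    scale-< : ∀ n → T ≤ n → ∀ {p q} → p <ℚ q → p * EOPT F n <ℚ q * EOPT F n
    scale-< n T≤n = QP.*-monoˡ-<-pos (EOPT F n) {{Q.positive (EOPT-pos′ n T≤n)}}
    EDNF≡1*EOPT : ∀ n → EDNF F n ≡ 1ℚ * EOPT F n
    EDNF≡1*EOPT n = trans (EDNF≡EOPT OPT≡DNF n) (sym (QP.*-identityˡ (EOPT F n)))
    below : ∀ n → T ≤ n → ∀ {ε} → 0ℚ <ℚ ε → (1ℚ - ε) * EOPT F n <ℚ EDNF F n
    below n T≤n {ε} 0<ε = subst ((1ℚ - ε) * EOPT F n <ℚ_) (sym (EDNF≡1*EOPT n))
      (scale-< n T≤n (subst (1ℚ - ε <ℚ_) (QP.+-identityʳ 1ℚ) (QP.+-monoʳ-< 1ℚ (QP.neg-antimono-< 0<ε))))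
    above : ∀ n → T ≤ n → ∀ {ε} → 0ℚ <ℚ ε → EDNF F n <ℚ (1ℚ + ε) * EOPT F n
    above n T≤n {ε} 0<ε = subst (_<ℚ (1ℚ + ε) * EOPT F n) (sym (EDNF≡1*EOPT n))
      (scale-< n T≤n (subst (_<ℚ 1ℚ + ε) (QP.+-identityʳ 1ℚ) (QP.+-monoʳ-< 1ℚ 0<ε)))

module PeriodicChain (F : DiscreteDist) {d : ℕ} (2≤d : 2 ≤ d) (periodic : Periodic F d) where

  d∣return-time : ∀ {xs} → SupportSeq F xs → 1 ≤ length xs → run 0ℚ xs ≡ 0ℚ → d ∣ length xs
  d∣return-time {xs} Sxs 1≤|xs| back = proj₁ (periodic 0ℚ ([] , [] , refl)) (length xs) (1≤|xs| , xs , Sxs , refl , back)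

  ¬d∣consecutive : ∀ {a} → d ∣ a → ¬ (d ∣ suc a)
  ¬d∣consecutive {a} d∣a d∣1+a with ∣1⇒≡1 (∣m+n∣m⇒∣n (subst (d ∣_) (ℕP.+-comm 1 a) d∣1+a) d∣a)
  ... | refl = ℕP.<-irrefl refl 2≤d

  support-nonneg : ∀ {x} → InSupport F x → 0ℚ ≤ℚ x
  support-nonneg (_ , x∈) = All.lookup (size-nonneg F) x∈

  zero∉support : ¬ InSupport F 0ℚ
  zero∉support S0 = ¬d∣consecutive (d ∣0) (d∣return-time (S0 ∷ []) (s≤s z≤n) (step-< {0ℚ} {0ℚ} 0<1))

  support-pos : ∀ {x} → InSupport F x → 0ℚ <ℚ x
  support-pos {x} Sx with x ≤ℚ? 0ℚ
  ... | yes x≤0 = ⊥-elim (zero∉support (subst (InSupport F) (QP.≤-antisym x≤0 (support-nonneg Sx)) Sx))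
  ... | no  x≰0 = QP.≰⇒> x≰0

  largest : ℚ × ℚ
  largest = Extrema.argmax proj₁ (proj₁ (some-atom F)) (atoms F)

  M : ℚ
  M = proj₁ largest

  M-support : InSupport F M
  M-support = proj₂ largest , Extrema.argmax-all proj₁ (proj₂ (some-atom F)) (All.tabulate (λ a∈ → a∈))

  ≤M : ∀ {x} → InSupport F x → x ≤ℚ M
  ≤M (_ , x∈) = All.lookup (Extrema.f[xs]≤f[argmax] (proj₁ (some-atom F)) (atoms F)) x∈

  threshold : ∃[ t ] (Σℚ (replicate t M) <ℚ 1ℚ × 1ℚ ≤ℚ Σℚ (replicate (suc t) M))
  threshold with archimedean (support-pos M-support)
  ... | k , 1≤kM = first-crossing M k 1≤kM

  t : ℕ
  t = proj₁ threshold

  short-Σ<1 : ∀ {u} → SupportSeq F u → length u ≤ t → Σℚ u <ℚ 1ℚ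
  short-Σ<1 Su |u|≤t = QP.≤-<-trans (Σℚ≤Σℚ-replicate (All.map ≤M Su))
    (QP.≤-<-trans (Σℚ-replicate-mono (support-nonneg M-support) |u|≤t) (proj₁ (proj₂ threshold)))

  -- Otherwise p ++ [M] and p ++ [y , M] would be returns to c of consecutive lengths.
  closes-with-any : ∀ {p y} → SupportSeq F p → Σℚ p <ℚ 1ℚ → 1ℚ ≤ℚ Σℚ p + M → InSupport F y → 1ℚ ≤ℚ Σℚ p + y
  closes-with-any {p} {y} Sp Σp<1 1≤Σp+M Sy with 1ℚ ≤ℚ? Σℚ p + y
  ... | yes 1≤Σp+y = 1≤Σp+y
  ... | no  1≰Σp+y = ⊥-elim (¬d∣consecutive (d∣return-time (AllP.++⁺ Sp (M-support ∷ [])) (1≤length p []) back₁)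
                                              (subst (d ∣_) |p+yM|≡ (d∣return-time (AllP.++⁺ Sp (Sy ∷ M-support ∷ [])) (1≤length p (M ∷ [])) back₂)))
    where
    1≤length : ∀ (u v : List ℚ) {x} → 1 ≤ length (u ++ x ∷ v)
    1≤length u v = subst (1 ≤_) (sym (LP.length-++ u)) (ℕP.≤-trans (s≤s z≤n) (ℕP.m≤n+m _ (length u)))
    run-p : run 0ℚ p ≡ Σℚ p
    run-p = trans (run-< 0ℚ (All.map support-nonneg Sp) (subst (_<ℚ 1ℚ) (sym (QP.+-identityˡ (Σℚ p))) Σp<1)) (QP.+-identityˡ (Σℚ p))
    Σp+y<1 : Σℚ p + y <ℚ 1ℚ
    Σp+y<1 = QP.≰⇒> 1≰Σp+y
    back₁ : run 0ℚ (p ++ M ∷ []) ≡ 0ℚ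
    back₁ = trans (run-++ 0ℚ p (M ∷ [])) (trans (cong (λ ℓ → step ℓ M) run-p) (step-≥ {Σℚ p} 1≤Σp+M))
    back₂ : run 0ℚ (p ++ y ∷ M ∷ []) ≡ 0ℚ
    back₂ = begin
      run 0ℚ (p ++ y ∷ M ∷ [])   ≡⟨ run-++ 0ℚ p (y ∷ M ∷ []) ⟩
      step (step (run 0ℚ p) y) M ≡⟨ cong (λ ℓ → step (step ℓ y) M) run-p ⟩
      step (step (Σℚ p) y) M     ≡⟨ cong (λ ℓ → step ℓ M) (step-< {Σℚ p} Σp+y<1) ⟩
      step (Σℚ p + y) M          ≡⟨ step-≥ {Σℚ p + y} (QP.≤-trans 1≤Σp+M (QP.+-monoˡ-≤ M (p≤p+q (Σℚ p) (support-nonneg Sy)))) ⟩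
      0ℚ                         ∎
      where open ≡-Reasoning
    |p+yM|≡ : length (p ++ y ∷ M ∷ []) ≡ suc (length (p ++ M ∷ []))
    |p+yM|≡ = trans (LP.length-++ p) (trans (ℕP.+-suc (length p) 1) (cong suc (sym (LP.length-++ p))))

  padded-1≤Σ : ∀ u m → SupportSeq F u → length u ℕ.+ m ≡ suc t → 1ℚ ≤ℚ Σℚ (u ++ replicate m M)
  padded-1≤Σ []      m _         m≡T   = subst (λ k → 1ℚ ≤ℚ Σℚ (replicate k M)) (sym m≡T) (proj₂ (proj₂ threshold))
  padded-1≤Σ (x ∷ u) m (Sx ∷ Su) |xu|+m≡T =
    subst (1ℚ ≤ℚ_) (QP.+-comm (Σℚ p) x) (closes-with-any Sp (short-Σ<1 Sp (ℕP.≤-reflexive |p|≡t)) 1≤Σp+M Sx)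
    where
    p : List ℚ
    p = u ++ replicate m M
    Sp : SupportSeq F p
    Sp = AllP.++⁺ Su (AllP.replicate⁺ m M-support)
    |p|≡t : length p ≡ t
    |p|≡t = ℕP.suc-injective (trans (cong suc (trans (LP.length-++ u) (cong (length u ℕ.+_) (LP.length-replicate m)))) |xu|+m≡T)
    1≤Σp+M : 1ℚ ≤ℚ Σℚ p + M
    1≤Σp+M = subst (1ℚ ≤ℚ_) (Σℚ-insert u M (replicate m M)) (padded-1≤Σ u (suc m) Su (trans (ℕP.+-suc (length u) m) |xu|+m≡T))

  full-1≤Σ : ∀ {u} → SupportSeq F u → length u ≡ suc t → 1ℚ ≤ℚ Σℚ u
  full-1≤Σ {u} Su |u|≡T = subst (λ v → 1ℚ ≤ℚ Σℚ v) (LP.++-identityʳ u) (padded-1≤Σ u 0 Su (trans (ℕP.+-identityʳ (length u)) |u|≡T))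

lemma2 : (F : DiscreteDist) (d : ℕ) → 2 ≤ d → Periodic F d → AECR-DNF≡1 F
lemma2 F d 2≤d periodic = AECR-DNF≡1-if-optimal F (suc t) OPT≡DNF OPT-pos
  where
  open PeriodicChain F 2≤d periodic
  open UniformBins (InSupport F) t support-nonneg short-Σ<1 full-1≤Σ
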